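{- Let $K$ be a discrete $d$-pseudomanifold and let $K_n \le K$ be a complete subgraph on $n$ vertices. Then the complementary dual $\hat{K}_n = \bigcap_{y\in K_n} L(y)$ is a discrete $(d-n)$-pseudomanifold.
   Context: All graphs are finite simple graphs. For a vertex $x$ of a graph $G$, the unit link $L(x)$ is the subgraph of $G$ induced by the neighbors of $x$. Discrete pseudomanifolds are defined recursively: the empty graph is the $(-1)$-pseudomanifold; a $1$-pseudomanifold is a cycle graph $C_n$ with $n\ge4$; a discrete $d$-pseudomanifold is a finite simple graph in which every unit link is a $(d-1)$-pseudomanifold. For a subgraph $H$ of $G$, the complementary dual $\hat H$ of $H$ in $G$ is the intersection $\bigcap_{y\in H} L(y)$ of the unit links of the vertices of $H$ (an induced subgraph of $G$). -}

module Defs where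

open import Data.Nat using (ℕ; zero; suc; _≤_)
open import Data.Fin using (Fin; toℕ)
open import Data.Integer using (ℤ; +_; -[1+_])
open import Data.Product using (Σ; _×_; ∃)
open import Data.Sum using (_⊎_)
open import Data.Empty using (⊥)
open import Relation.Nullary using (¬_)
open import Relation.Binary.PropositionalEquality using (_≡_)
open import Relation.Binary using (Decidable)
open import Function.Definitions using (Injective)
open import Function.Bundles using (_⇔_)

record Graph : Set₁ where
  field
    N     : ℕ
    Adj   : Fin N → Fin N → Set
    adj?  : Decidable Adj
    sym   : ∀ {x y} → Adj x y → Adj y x
    irrefl : ∀ {x} → ¬ Adj x x

module _ (G : Graph) where
  open Graph G

  -- Vertex sets; a vertex set S stands for the induced subgraph G[S].
  VSet : Set₁
  VSet = Fin N → Set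

  link : VSet → Fin N → VSet
  link S x = λ y → S y × Adj x y

  CycAdj : (m : ℕ) → Fin m → Fin m → Set
  CycAdj m i j =
      (suc (toℕ i) ≡ toℕ j)
    ⊎ (suc (toℕ j) ≡ toℕ i)
    ⊎ (toℕ i ≡ 0 × suc (toℕ j) ≡ m)
    ⊎ (toℕ j ≡ 0 × suc (toℕ i) ≡ m)

  IsCycle : VSet → Set
  IsCycle S = Σ ℕ λ m → (4 ≤ m) × Σ (Fin m → Fin N) λ f →
      Injective _≡_ _≡_ f
    × (∀ i → S (f i))
    × (∀ v → S v → ∃ λ i → f i ≡ v)
    × (∀ i j → Adj (f i) (f j) ⇔ CycAdj m i j)

  -- PM k S : G[S] is a discrete (k-1)-pseudomanifold.
  PM : ℕ → VSet → Set
  PM zero S = ∀ v → ¬ S v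
  PM (suc zero) S = ∀ x → S x → PM zero (link S x)
  PM (suc (suc zero)) S = IsCycle S
  PM (suc (suc (suc k))) S = ∀ x → S x → PM (suc (suc k)) (link S x)

  IsPM : ℤ → VSet → Set
  IsPM (+ k) S = PM (suc k) S
  IsPM -[1+ zero ] S = PM zero S
  IsPM -[1+ suc _ ] S = ⊥

  Full : VSet
  Full _ = Data.Unit.⊤
    where import Data.Unit

  IsClique : (n : ℕ) → (Fin n → Fin N) → Set
  IsClique n f = Injective _≡_ _≡_ f × (∀ i j → ¬ (i ≡ j) → Adj (f i) (f j))

  dual : (n : ℕ) → (Fin n → Fin N) → VSet
  dual n f v = ∀ i → Adj (f i) v

{-# OPTIONS --safe #-}
module Submission where

-- Intersecting the unit links of a clique one vertex at a time exhibits the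
-- complementary dual of K_{n+1} as the unit link of a vertex inside the
-- complementary dual of K_n, so by induction it is an iterated unit link and
-- each step lowers the dimension by one. The only step not immediate from the
-- definition is at dimension 1: a unit link in a cycle C_m with m ≥ 4 has no
-- edges, because such a cycle has no triangles. The same induction bounds the
-- clique size by d + 1, since the dual of a clique contains every further
-- clique vertex but the dual of a clique of size d + 1 is already empty.

open import Defs
open import Data.Nat as ℕ using (ℕ; zero; suc; _≤_; z≤n; s≤s)
open import Data.Fin using (Fin)
open import Data.Integer using (ℤ; _-_; +_; -[1+_]; _+_)
open import Data.Nat.Properties using (+-suc; +-identityʳ; m≤n⇒m<n∨m≡n; m≤n⇒∃[o]m+o≡n)
open import Data.Integer.Properties using (pos-+)
open import Data.Integer.Tactic.RingSolver using (solve-∀)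
open import Data.Fin.Properties using (suc-injective)
open import Data.Product using (∃; _×_; _,_)
open import Data.Sum using (_⊎_; inj₁; inj₂)
open import Data.Empty using (⊥-elim)
open import Data.Unit using (tt)
open import Function.Bundles using (Equivalence)
open import Relation.Nullary using (¬_)
open import Relation.Unary using (_≐_)
open import Relation.Binary.PropositionalEquality using (_≡_; refl; sym; subst)

CycAdjℕ : ℕ → ℕ → ℕ → Set
CycAdjℕ m a b = (suc a ≡ b) ⊎ (suc b ≡ a) ⊎ (a ≡ 0 × suc b ≡ m) ⊎ (b ≡ 0 × suc a ≡ m)

-- The cycle length is written 4 + k so that every configuration that would
-- need m ≤ 3 is refuted by unification.
module _ {k : ℕ} where
  private
    m : ℕ
    m = 4 ℕ.+ k

  CycAdjℕ-irrefl : ∀ {a} → ¬ CycAdjℕ m a a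
  CycAdjℕ-irrefl (inj₁ ())
  CycAdjℕ-irrefl (inj₂ (inj₁ ()))
  CycAdjℕ-irrefl (inj₂ (inj₂ (inj₁ (refl , ()))))
  CycAdjℕ-irrefl (inj₂ (inj₂ (inj₂ (refl , ()))))

  CycAdjℕ-no-triangle-on-step : ∀ {a c} → CycAdjℕ m (suc a) c → ¬ CycAdjℕ m a c
  CycAdjℕ-no-triangle-on-step (inj₁ refl) (inj₁ ())
  CycAdjℕ-no-triangle-on-step (inj₁ refl) (inj₂ (inj₁ ()))
  CycAdjℕ-no-triangle-on-step (inj₁ refl) (inj₂ (inj₂ (inj₁ (refl , ()))))
  CycAdjℕ-no-triangle-on-step (inj₁ refl) (inj₂ (inj₂ (inj₂ (() , _))))
  CycAdjℕ-no-triangle-on-step (inj₂ (inj₁ refl)) = CycAdjℕ-irrefl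
  CycAdjℕ-no-triangle-on-step (inj₂ (inj₂ (inj₁ (() , _))))
  CycAdjℕ-no-triangle-on-step (inj₂ (inj₂ (inj₂ (refl , refl)))) (inj₁ ())
  CycAdjℕ-no-triangle-on-step (inj₂ (inj₂ (inj₂ (refl , refl)))) (inj₂ (inj₂ (inj₁ (() , _))))

  CycAdjℕ-no-triangle-on-wrap : ∀ {b c} → suc b ≡ m → CycAdjℕ m b c → ¬ CycAdjℕ m 0 c
  CycAdjℕ-no-triangle-on-wrap refl (inj₁ refl) (inj₁ ())
  CycAdjℕ-no-triangle-on-wrap refl (inj₂ (inj₁ refl)) (inj₁ ())
  CycAdjℕ-no-triangle-on-wrap refl (inj₂ (inj₂ (inj₁ (() , _))))
  CycAdjℕ-no-triangle-on-wrap refl (inj₂ (inj₂ (inj₂ (refl , _)))) (inj₁ ())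
  CycAdjℕ-no-triangle-on-wrap _ _ (inj₂ (inj₁ ()))
  CycAdjℕ-no-triangle-on-wrap _ _ (inj₂ (inj₂ (inj₂ (refl , ()))))

  CycAdjℕ-triangle-free : ∀ {a b c} → CycAdjℕ m a b → CycAdjℕ m b c → ¬ CycAdjℕ m a c
  CycAdjℕ-triangle-free (inj₁ refl) bc ac = CycAdjℕ-no-triangle-on-step bc ac
  CycAdjℕ-triangle-free (inj₂ (inj₁ refl)) bc ac = CycAdjℕ-no-triangle-on-step ac bc
  CycAdjℕ-triangle-free (inj₂ (inj₂ (inj₁ (refl , b+1≡m)))) bc ac = CycAdjℕ-no-triangle-on-wrap b+1≡m bc ac
  CycAdjℕ-triangle-free (inj₂ (inj₂ (inj₂ (refl , a+1≡m)))) bc ac = CycAdjℕ-no-triangle-on-wrap a+1≡m ac bc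

module _ (K : Graph) where
  open Graph K using (N; Adj)

  IsCycle⇒triangle-free : ∀ {S x y z} → IsCycle K S → S x → S y → S z →
    Adj x y → Adj y z → ¬ Adj x z
  IsCycle⇒triangle-free (_ , s≤s (s≤s (s≤s (s≤s _))) , _ , _ , _ , onto , adj) Sx Sy Sz xy yz xz
    with onto _ Sx | onto _ Sy | onto _ Sz
  ... | i , refl | j , refl | l , refl =
    CycAdjℕ-triangle-free (to (adj i j) xy) (to (adj j l) yz) (to (adj i l) xz)
    where open Equivalence

  link-resp-≐ : ∀ {S T} x → S ≐ T → link K S x ≐ link K T x
  link-resp-≐ x (S⊆T , T⊆S) = (λ (s , a) → S⊆T s , a) , (λ (t , a) → T⊆S t , a)

  PM-resp-≐ : ∀ j {S T} → S ≐ T → PM K j S → PM K j T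
  PM-resp-≐ zero (_ , T⊆S) pm v t = pm v (T⊆S t)
  PM-resp-≐ (suc zero) (_ , T⊆S) pm x Tx v (Tv , a) = pm x (T⊆S Tx) v (T⊆S Tv , a)
  PM-resp-≐ (suc (suc zero)) (S⊆T , T⊆S) (m , 4≤m , g , inj , inS , onto , adj) =
    m , 4≤m , g , inj , (λ i → S⊆T (inS i)) , (λ v Tv → onto v (T⊆S Tv)) , adj
  PM-resp-≐ (suc (suc (suc j))) S≐T@(_ , T⊆S) pm x Tx =
    PM-resp-≐ (suc (suc j)) (link-resp-≐ x S≐T) (pm x (T⊆S Tx))

  PM-link : ∀ j {S x} → PM K (suc j) S → S x → PM K j (link K S x)
  PM-link zero pm Sx = pm _ Sx
  PM-link (suc zero) cycle Sx _ (Sy , xy) _ ((Sz , xz) , yz) =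
    IsCycle⇒triangle-free cycle Sx Sy Sz xy yz xz
  PM-link (suc (suc j)) pm Sx = pm _ Sx

  module _ {n} {f : Fin (suc n) → Fin N} where
    private
      tail : Fin n → Fin N
      tail i = f (Fin.suc i)

    IsClique-tail : IsClique K (suc n) f → IsClique K n tail
    IsClique-tail (inj , adj) =
      (λ e → suc-injective (inj e)) , λ i j i≢j → adj (Fin.suc i) (Fin.suc j) (λ e → i≢j (suc-injective e))

    IsClique-head∈dual-tail : IsClique K (suc n) f → dual K n tail (f Fin.zero)
    IsClique-head∈dual-tail (_ , adj) i = adj (Fin.suc i) Fin.zero (λ ())

    dual-suc≐link : link K (dual K n tail) (f Fin.zero) ≐ dual K (suc n) f
    dual-suc≐link = (λ (d , a) → λ { Fin.zero → a ; (Fin.suc i) → d i })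
                  , (λ d → (λ i → d (Fin.suc i)) , d Fin.zero)

  dual-zero≐Full : ∀ {f} → Full K ≐ dual K zero f
  dual-zero≐Full = (λ _ ()) , (λ _ → tt)

  PM-dual : ∀ {n f j} → IsClique K n f → PM K (n ℕ.+ j) (Full K) → PM K j (dual K n f)
  PM-dual {zero} {j = j} _ pm = PM-resp-≐ j dual-zero≐Full pm
  PM-dual {suc n} {f} {j} clique pm =
    PM-resp-≐ j dual-suc≐link (PM-link j pm-tail (IsClique-head∈dual-tail clique))
    where
    pm-tail : PM K (suc j) (dual K n (λ i → f (Fin.suc i)))
    pm-tail = PM-dual (IsClique-tail clique) (subst (λ e → PM K e (Full K)) (sym (+-suc n j)) pm)

  PM⇒clique-size≤ : ∀ {n f j} → IsClique K n f → PM K j (Full K) → n ≤ j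
  PM⇒clique-size≤ {zero} _ _ = z≤n
  PM⇒clique-size≤ {suc n} {f} clique pm with m≤n⇒m<n∨m≡n (PM⇒clique-size≤ (IsClique-tail clique) pm)
  ... | inj₁ n<j = n<j
  ... | inj₂ refl = ⊥-elim (empty _ (IsClique-head∈dual-tail clique))
    where
    empty : PM K 0 (dual K n (λ i → f (Fin.suc i)))
    empty = PM-dual (IsClique-tail clique) (subst (λ e → PM K e (Full K)) (sym (+-identityʳ n)) pm)

  IsPM⇒PM : ∀ d {S} → IsPM K d S → ∃ λ j → d ≡ -[1+ 0 ] + + j × PM K j S
  IsPM⇒PM (+ k) pm = suc k , refl , pm
  IsPM⇒PM -[1+ zero ] pm = zero , refl , pm

  PM⇒IsPM : ∀ j {S} → PM K j S → IsPM K (-[1+ 0 ] + + j) S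
  PM⇒IsPM zero pm = pm
  PM⇒IsPM (suc j) pm = pm

[-1+[m+n]]-m≡-1+n : ∀ m n → (-[1+ 0 ] + + (m ℕ.+ n)) - + m ≡ -[1+ 0 ] + + n
[-1+[m+n]]-m≡-1+n m n rewrite pos-+ m n = cancel (+ m) (+ n)
  where
  cancel : ∀ (a b : ℤ) → (-[1+ 0 ] + (a + b)) - a ≡ -[1+ 0 ] + b
  cancel = solve-∀

proposition3p3 : (K : Graph) (d : ℤ) → IsPM K d (Full K) →
    (n : ℕ) (f : Fin n → Fin (Graph.N K)) → IsClique K n f →
    IsPM K (d - + n) (dual K n f)
proposition3p3 K d pm n f clique with IsPM⇒PM K d pm
... | j , refl , pmʲ with m≤n⇒∃[o]m+o≡n (PM⇒clique-size≤ K clique pmʲ)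
... | i , refl = subst (λ e → IsPM K e (dual K n f)) (sym ([-1+[m+n]]-m≡-1+n n i))
                   (PM⇒IsPM K i (PM-dual K clique pmʲ))
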